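{- Let $G$ be a graph of order $n$ whose edges are coloured red, blue and green such that there is no monochromatic component of order at least $\frac n2$. Suppose that $G$ has $r$ red, $b$ blue and $g$ green components and there exist red components $R_1$ and $R_2$ such that $|R_1|+|R_2|<\frac n2$. Then there is a graph $G'$ together with a red/blue/green colouring of its edges such that $G'$ has $r-1$ red, $b$ blue and $g$ green components, $\frac{\delta(G')}{|V(G')|}\geq\frac{\delta(G)}{|V(G)|}$, and there is no monochromatic component in $G'$ of order at least $\frac12|V(G')|$.
   Context: $\delta(G)$ denotes the minimum degree of $G$. For an edge-colouring, a monochromatic (e.g. red) component is a connected component of the graph formed by the edges of that colour (on the vertices incident with such edges); its order $|R|$ is its number of vertices. -}

module Defs where

open import Data.Nat using (ℕ; zero; suc; _+_; _*_; _⊓_; _<_)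
open import Data.Fin using (Fin)
open import Data.Maybe using (Maybe; just; nothing; is-just)
open import Data.Bool using (if_then_else_)
open import Data.List using (List; length; map; foldr; allFin)
open import Data.Nat.ListAction using (sum)
open import Data.List.Membership.Propositional using (_∈_)
open import Data.List.Relation.Unary.Unique.Propositional using (Unique)
open import Data.Product using (Σ; ∃; _×_; _,_; proj₁)
open import Function.Bundles using (_⇔_)
open import Relation.Binary.PropositionalEquality using (_≡_)
open import Relation.Binary.Construct.Closure.Transitive using (TransClosure)
open import Relation.Nullary using (¬_)

data Colour : Set where
  red blue green : Colour

-- A finite simple graph on vertex set Fin n whose edges are coloured:
-- col u v ≡ nothing means "no edge", col u v ≡ just k means "edge of colour k".
record ColouredGraph (n : ℕ) : Set where
  field
    col    : Fin n → Fin n → Maybe Colour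
    sym    : ∀ u v → col u v ≡ col v u
    irrefl : ∀ u → col u u ≡ nothing
open ColouredGraph public

Edge : ∀ {n} → ColouredGraph n → Colour → Fin n → Fin n → Set
Edge G k u v = col G u v ≡ just k

-- Conn G k v v holds iff v is
-- incident with a colour-k edge, i.e. v is a vertex of some k-component.
Conn : ∀ {n} → ColouredGraph n → Colour → Fin n → Fin n → Set
Conn G k = TransClosure (Edge G k)

KVertex : ∀ {n} → ColouredGraph n → Colour → Set
KVertex {n} G k = Σ (Fin n) λ v → Conn G k v v

-- G has exactly r components of colour k: the components are labelled
-- bijectively by Fin r.
NumComponents : ∀ {n} → ColouredGraph n → Colour → ℕ → Set
NumComponents G k r =
  Σ (KVertex G k → Fin r) λ f →
    (∀ x y → (f x ≡ f y) ⇔ Conn G k (proj₁ x) (proj₁ y)) ×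
    (∀ i → ∃ λ x → f x ≡ i)

ComponentOrder : ∀ {n} → ColouredGraph n → Colour → Fin n → ℕ → Set
ComponentOrder {n} G k v m =
  Conn G k v v ×
  (∃ λ (xs : List (Fin n)) →
    Unique xs × (∀ u → (u ∈ xs) ⇔ Conn G k v u) × length xs ≡ m)

NoLargeMonoComponent : ∀ {n} → ColouredGraph n → Set
NoLargeMonoComponent {n} G =
  ∀ k v m → ComponentOrder G k v m → 2 * m < n

deg : ∀ {n} → ColouredGraph n → Fin n → ℕ
deg {n} G v = sum (map (λ u → if is-just (col G v u) then 1 else 0) (allFin n))

minDeg : ∀ {n} → ColouredGraph n → ℕ
minDeg {zero}  G = 0
minDeg {suc m} G = foldr _⊓_ (deg G Fin.zero) (map (deg G) (allFin (suc m)))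

module Submission where

-- The graph G′ lives on two copies of V(G): two copies
-- are joined, in the same colour, exactly when their originals are; then the
-- edge between the first copies of x and y is coloured red (added if absent,
-- recoloured otherwise).  Properties of G′:
--   * every monochromatic walk of G lifts to G′ between arbitrary copies
--     (an overwritten edge x y survives via the second copies), and every walk
--     of G′ projects to G, except that in red the new edge merges R₁ and R₂;
--     hence G′ has r - 1 red, b blue and g green components;
--   * every vertex of G′ has at least twice the degree of its original, so
--     δ(G)·2n ≤ δ(G′)·n;
--   * a component of G′ has at most twice as many vertices as its projection,
--     which is a component of G or lies in R₁ ∪ R₂, so it is below half of 2n.

open import Defs hiding (sym; irrefl)
open import Data.Nat using (ℕ; zero; suc; _+_; _*_; _∸_; _<_; _≤_; _⊓_; z≤n; s≤s)
open import Data.Nat.Properties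
  using (module ≤-Reasoning; ≤-refl; ≤-trans; ≤-<-trans; +-mono-≤; +-mono-<; +-identityʳ; +-assoc;
         ⊓-glb; m⊓n≤m; m⊓n≤n; *-monoʳ-≤; *-monoˡ-≤; *-distribˡ-+; *-distribʳ-+)
open import Data.Fin as Fin using (Fin; _↑ˡ_; _↑ʳ_; splitAt; punchIn; punchOut)
open import Data.Fin.Properties
  using (splitAt-↑ˡ; splitAt-↑ʳ; splitAt⁻¹-↑ˡ; splitAt⁻¹-↑ʳ;
         punchOut-injective; punchOut-cong; punchOut-punchIn; punchInᵢ≢i)
  renaming (_≟_ to _≟ᶠ_)
open import Data.Maybe using (Maybe; just; nothing; is-just)
open import Data.Maybe.Properties using (just-injective)
open import Data.Bool using (if_then_else_)
open import Data.List using (List; []; _∷_; length; map; foldr; allFin; tabulate; _++_; deduplicate)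
open import Data.List.Properties using (map-tabulate; length-++; length-map; length-removeAt′; foldr-preservesᵇ)
open import Data.Nat.ListAction using (sum)
open import Data.List.Membership.Propositional using (_∈_)
open import Data.List.Membership.Propositional.Properties
  using (∈-allFin; ∈-map⁺; ∈-map⁻; ∈-++⁺ˡ; ∈-++⁺ʳ; ∈-deduplicate⁺; ∈-deduplicate⁻)
open import Data.List.Relation.Binary.Subset.Propositional using (_⊆_)
open import Data.List.Relation.Unary.Any using (here; there; index; _─_; any?)
open import Data.List.Relation.Unary.All using () renaming (lookup to All-lookup; tabulate to All-tabulate)
open import Data.List.Relation.Unary.All.Properties using (map⁺)
open import Data.List.Relation.Unary.Unique.Propositional using (Unique; _∷_)
import Data.List.Relation.Unary.Unique.DecPropositional.Properties as DecUnique
open import Data.Product using (Σ; ∃; _×_; _,_; proj₁; proj₂)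
open import Data.Sum using (_⊎_; inj₁; inj₂; [_,_]′)
open import Data.Empty using (⊥-elim)
open import Function using (id; _∘_)
open import Function.Bundles using (_⇔_; mk⇔; Equivalence)
open import Relation.Binary.PropositionalEquality
open import Relation.Binary.Construct.Closure.Transitive using ([_]; _∷_; symmetric) renaming (_++_ to _⁺++_)
open import Relation.Nullary using (¬_; Dec; yes; no)
open import Relation.Nullary.Decidable using (_×-dec_; _⊎-dec_; map′)

open Equivalence using (to; from)

∈-─ : ∀ {A : Set} {x z : A} (ys : List A) (p : x ∈ ys) → z ∈ ys → z ≢ x → z ∈ (ys ─ p)
∈-─ (y ∷ ys) (here refl) (here refl) z≢x = ⊥-elim (z≢x refl)
∈-─ (y ∷ ys) (here refl) (there z∈ys) _ = z∈ys
∈-─ (y ∷ ys) (there p)   (here z≡y)   _ = here z≡y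
∈-─ (y ∷ ys) (there p)   (there z∈ys) z≢x = there (∈-─ ys p z∈ys z≢x)

unique⊆⇒length≤ : ∀ {A : Set} {xs ys : List A} → Unique xs → xs ⊆ ys → length xs ≤ length ys
unique⊆⇒length≤ {xs = []} _ _ = z≤n
unique⊆⇒length≤ {xs = x ∷ xs} {ys} (x∉xs ∷ unique) xs⊆ys =
  subst (suc (length xs) ≤_) (sym (length-removeAt′ ys (index x∈ys))) (s≤s (unique⊆⇒length≤ unique rest⊆))
  where
  x∈ys : x ∈ ys
  x∈ys = xs⊆ys (here refl)
  rest⊆ : xs ⊆ (ys ─ x∈ys)
  rest⊆ z∈xs = ∈-─ ys x∈ys (xs⊆ys (there z∈xs)) (λ z≡x → All-lookup x∉xs z∈xs (sym z≡x))

present : Maybe Colour → ℕ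
present m = if is-just m then 1 else 0

present-mono : ∀ (m m′ : Maybe Colour) → (∀ {k} → m ≡ just k → ∃ λ l → m′ ≡ just l) → present m ≤ present m′
present-mono nothing  _ _ = z≤n
present-mono (just k) m′ preserved with preserved refl
... | l , refl = ≤-refl

deg-tabulate : ∀ {n} (G : ColouredGraph n) v → deg G v ≡ sum (tabulate (λ u → present (col G v u)))
deg-tabulate {n} G v = cong sum (map-tabulate {n = n} id (λ u → present (col G v u)))

sum-tabulate-+ : ∀ m n (h : Fin (m + n) → ℕ) →
  sum (tabulate h) ≡ sum (tabulate (λ i → h (i ↑ˡ n))) + sum (tabulate (λ i → h (m ↑ʳ i)))
sum-tabulate-+ zero    n h = refl
sum-tabulate-+ (suc m) n h = begin
  h Fin.zero + sum (tabulate (h ∘ Fin.suc))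
    ≡⟨ cong (h Fin.zero +_) (sum-tabulate-+ m n (h ∘ Fin.suc)) ⟩
  h Fin.zero + (sum (tabulate (λ i → h (Fin.suc (i ↑ˡ n)))) + sum (tabulate (λ i → h (Fin.suc (m ↑ʳ i)))))
    ≡⟨ sym (+-assoc (h Fin.zero) _ _) ⟩
  (h Fin.zero + sum (tabulate (λ i → h (Fin.suc (i ↑ˡ n))))) + sum (tabulate (λ i → h (Fin.suc (m ↑ʳ i)))) ∎
  where open ≡-Reasoning

sum-tabulate-mono : ∀ n {f g : Fin n → ℕ} → (∀ i → f i ≤ g i) → sum (tabulate f) ≤ sum (tabulate g)
sum-tabulate-mono zero    f≤g = z≤n
sum-tabulate-mono (suc n) f≤g = +-mono-≤ (f≤g Fin.zero) (sum-tabulate-mono n (f≤g ∘ Fin.suc))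

foldr-⊓-≤ : ∀ e xs {z} → z ∈ xs → foldr _⊓_ e xs ≤ z
foldr-⊓-≤ e (z ∷ xs) (here refl) = m⊓n≤m z _
foldr-⊓-≤ e (w ∷ xs) (there z∈xs) = ≤-trans (m⊓n≤n w _) (foldr-⊓-≤ e xs z∈xs)

minDeg≤deg : ∀ {n} (G : ColouredGraph n) v → minDeg G ≤ deg G v
minDeg≤deg {suc n} G v = foldr-⊓-≤ (deg G Fin.zero) _ (∈-map⁺ (deg G) (∈-allFin v))

minDeg-greatest : ∀ {n c} (G : ColouredGraph (suc n)) → (∀ v → c ≤ deg G v) → c ≤ minDeg G
minDeg-greatest {n} {c} G c≤deg =
  foldr-preservesᵇ {P = c ≤_} ⊓-glb {xs = map (deg G) (allFin (suc n))}
    (c≤deg Fin.zero) (map⁺ (All-tabulate (λ {v} _ → c≤deg v)))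

minDeg-scale : ∀ {n n′} c (G : ColouredGraph n) (H : ColouredGraph (suc n′)) (φ : Fin (suc n′) → Fin n) →
  (∀ p → c * deg G (φ p) ≤ deg H p) → c * minDeg G ≤ minDeg H
minDeg-scale c G H φ scaled =
  minDeg-greatest H (λ p → ≤-trans (*-monoʳ-≤ c (minDeg≤deg G (φ p))) (scaled p))

scale-by-order : ∀ {d d′} n → 2 * d ≤ d′ → d * (n + n) ≤ d′ * n
scale-by-order {d} {d′} n 2d≤d′ = begin
  d * (n + n)   ≡⟨ *-distribˡ-+ d n n ⟩
  d * n + d * n ≡⟨ sym (*-distribʳ-+ n d d) ⟩
  (d + d) * n   ≡⟨ cong (λ e → (d + e) * n) (sym (+-identityʳ d)) ⟩
  2 * d * n     ≤⟨ *-monoˡ-≤ n 2d≤d′ ⟩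
  d′ * n        ∎
  where open ≤-Reasoning

double-< : ∀ {m u n} → m ≤ u + u → 2 * u < n → 2 * m < n + n
double-< {m} {u} {n} m≤2u 2u<n = begin-strict
  2 * m         ≤⟨ *-monoʳ-≤ 2 m≤2u ⟩
  2 * (u + u)   ≡⟨ *-distribˡ-+ 2 u u ⟩
  2 * u + 2 * u <⟨ +-mono-< 2u<n 2u<n ⟩
  n + n         ∎
  where open ≤-Reasoning

-- This forces
-- E to be an equivalence with exactly c classes; NumComponents G k c is the
-- case V = KVertex G k, E = Conn G k.
Labelling : (V : Set) → (V → V → Set) → ℕ → Set
Labelling V E c = Σ (V → Fin c) λ f → (∀ u v → (f u ≡ f v) ⇔ E u v) × (∀ i → ∃ λ v → f v ≡ i)

labelling-pullback : ∀ {V W : Set} {E : V → V → Set} {F : W → W → Set} {c} (h : W → V) →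
  (∀ u v → F u v ⇔ E (h u) (h v)) → (∀ v → ∃ λ w → E (h w) v) →
  Labelling V E c → Labelling W F c
labelling-pullback {E = E} {F} h F⇔E meets (f , kernel , onto) = f ∘ h , kernel′ , onto′
  where
  kernel′ : ∀ u v → (f (h u) ≡ f (h v)) ⇔ F u v
  kernel′ u v = mk⇔ (from (F⇔E u v) ∘ to (kernel (h u) (h v))) (from (kernel (h u) (h v)) ∘ to (F⇔E u v))
  onto′ : ∀ i → ∃ λ w → f (h w) ≡ i
  onto′ i with onto i
  ... | v , fv≡i with meets v
  ...   | w , Ehwv = w , trans (from (kernel (h w) v) Ehwv) fv≡i

module Collapse {r} (i j : Fin (suc r)) (i≢j : i ≢ j) where

  InPair : Fin (suc r) → Set
  InPair k = k ≡ i ⊎ k ≡ j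

  redirect : Fin (suc r) → Fin (suc r)
  redirect k with k ≟ᶠ j
  ... | yes _ = i
  ... | no  _ = k

  redirect-spec : ∀ k → (k ≡ j × redirect k ≡ i) ⊎ (k ≢ j × redirect k ≡ k)
  redirect-spec k with k ≟ᶠ j
  ... | yes k≡j = inj₁ (k≡j , refl)
  ... | no  k≢j = inj₂ (k≢j , refl)

  redirect≢j : ∀ k → j ≢ redirect k
  redirect≢j k with redirect-spec k
  ... | inj₁ (_ , rk≡i) = λ j≡rk → i≢j (sym (trans j≡rk rk≡i))
  ... | inj₂ (k≢j , rk≡k) = λ j≡rk → k≢j (sym (trans j≡rk rk≡k))

  redirect-pair : ∀ {k} → InPair k → redirect k ≡ i
  redirect-pair {k} pair with redirect-spec k | pair
  ... | inj₁ (_ , rk≡i) | _ = rk≡i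
  ... | inj₂ (_ , rk≡k) | inj₁ k≡i = trans rk≡k k≡i
  ... | inj₂ (k≢j , _)  | inj₂ k≡j = ⊥-elim (k≢j k≡j)

  redirect-≡ : ∀ k l → redirect k ≡ redirect l → k ≡ l ⊎ (InPair k × InPair l)
  redirect-≡ k l e with redirect-spec k | redirect-spec l
  ... | inj₁ (k≡j , _) | inj₁ (l≡j , _) = inj₁ (trans k≡j (sym l≡j))
  ... | inj₁ (k≡j , rk≡i) | inj₂ (_ , rl≡l) = inj₂ (inj₂ k≡j , inj₁ (trans (sym rl≡l) (trans (sym e) rk≡i)))
  ... | inj₂ (_ , rk≡k) | inj₁ (l≡j , rl≡i) = inj₂ (inj₁ (trans (sym rk≡k) (trans e rl≡i)) , inj₂ l≡j)
  ... | inj₂ (_ , rk≡k) | inj₂ (_ , rl≡l) = inj₁ (trans (sym rk≡k) (trans e rl≡l))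

  collapse : Fin (suc r) → Fin r
  collapse k = punchOut (redirect≢j k)

  collapse-≡ : ∀ k l → (collapse k ≡ collapse l) ⇔ (k ≡ l ⊎ (InPair k × InPair l))
  collapse-≡ k l = mk⇔
    (redirect-≡ k l ∘ punchOut-injective (redirect≢j k) (redirect≢j l))
    (punchOut-cong j ∘ identified)
    where
    identified : k ≡ l ⊎ (InPair k × InPair l) → redirect k ≡ redirect l
    identified (inj₁ refl) = refl
    identified (inj₂ (pk , pl)) = trans (redirect-pair pk) (sym (redirect-pair pl))

  collapse-punchIn : ∀ t → collapse (punchIn j t) ≡ t
  collapse-punchIn t with redirect-spec (punchIn j t)
  ... | inj₁ (jt≡j , _) = ⊥-elim (punchInᵢ≢i j t jt≡j)
  ... | inj₂ (_ , rjt≡jt) = trans (punchOut-cong j rjt≡jt) (punchOut-punchIn j)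

Merge : ∀ {V : Set} → (V → V → Set) → V → V → V → V → Set
Merge E x y u v = E u v ⊎ ((E x u ⊎ E y u) × (E x v ⊎ E y v))

labelling-merge : ∀ {V : Set} {E : V → V → Set} {r} (x y : V) → ¬ E x y →
  Labelling V E (suc r) → Labelling V (Merge E x y) r
labelling-merge {E = E} x y ¬Exy (f , kernel , onto) = collapse ∘ f , kernel′ , onto′
  where
  open Collapse (f x) (f y) (¬Exy ∘ to (kernel x y))

  pair⇔near : ∀ v → InPair (f v) ⇔ (E x v ⊎ E y v)
  pair⇔near v = mk⇔
    [ inj₁ ∘ to (kernel x v) ∘ sym , inj₂ ∘ to (kernel y v) ∘ sym ]′
    [ inj₁ ∘ sym ∘ from (kernel x v) , inj₂ ∘ sym ∘ from (kernel y v) ]′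

  kernel′ : ∀ u v → (collapse (f u) ≡ collapse (f v)) ⇔ Merge E x y u v
  kernel′ u v = mk⇔
    ([ inj₁ ∘ to (kernel u v) , (λ (pu , pv) → inj₂ (to (pair⇔near u) pu , to (pair⇔near v) pv)) ]′
      ∘ to (collapse-≡ (f u) (f v)))
    (from (collapse-≡ (f u) (f v))
      ∘ [ inj₁ ∘ from (kernel u v) , (λ (nu , nv) → inj₂ (from (pair⇔near u) nu , from (pair⇔near v) nv)) ]′)

  onto′ : ∀ t → ∃ λ v → collapse (f v) ≡ t
  onto′ t with onto (punchIn (f y) t)
  ... | v , fv≡ = v , trans (cong collapse fv≡) (collapse-punchIn t)

Adjacent : ∀ {n} → ColouredGraph n → Fin n → Fin n → Set
Adjacent G u v = ∃ λ k → Edge G k u v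

module TwoCopies (n : ℕ) where

  left right : Fin n → Fin (n + n)
  left u = u ↑ˡ n
  right u = n ↑ʳ u

  base : Fin (n + n) → Fin n
  base p = [ id , id ]′ (splitAt n p)

  base-left : ∀ u → base (left u) ≡ u
  base-left u rewrite splitAt-↑ˡ n u n = refl

  base-right : ∀ u → base (right u) ≡ u
  base-right u rewrite splitAt-↑ʳ n n u = refl

  left-or-right : ∀ p → p ≡ left (base p) ⊎ p ≡ right (base p)
  left-or-right p with splitAt n p in eq
  ... | inj₁ _ = inj₁ (sym (splitAt⁻¹-↑ˡ eq))
  ... | inj₂ _ = inj₂ (sym (splitAt⁻¹-↑ʳ eq))

  left≢right : ∀ u v → left u ≢ right v
  left≢right u v e with trans (sym (splitAt-↑ˡ n u n)) (trans (cong (splitAt n) e) (splitAt-↑ʳ n n v))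
  ... | ()

  copies-length : ∀ {ps : List (Fin (n + n))} {us : List (Fin n)} →
    Unique ps → (∀ {p} → p ∈ ps → base p ∈ us) → length ps ≤ length us + length us
  copies-length {ps} {us} unique bases = subst (length ps ≤_) length-copies (unique⊆⇒length≤ unique ps⊆copies)
    where
    ps⊆copies : ps ⊆ map left us ++ map right us
    ps⊆copies {p} p∈ps with left-or-right p
    ... | inj₁ p≡ = subst (_∈ map left us ++ map right us) (sym p≡) (∈-++⁺ˡ (∈-map⁺ left (bases p∈ps)))
    ... | inj₂ p≡ = subst (_∈ map left us ++ map right us) (sym p≡) (∈-++⁺ʳ (map left us) (∈-map⁺ right (bases p∈ps)))
    length-copies : length (map left us ++ map right us) ≡ length us + length us
    length-copies = trans (length-++ (map left us)) (cong₂ _+_ (length-map left us) (length-map right us))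

  deg-blowup : (G : ColouredGraph n) (H : ColouredGraph (n + n)) →
    (∀ p q → Adjacent G (base p) (base q) → Adjacent H p q) → ∀ p → 2 * deg G (base p) ≤ deg H p
  deg-blowup G H blowup p = begin
    2 * deg G (base p)                    ≡⟨ cong (deg G (base p) +_) (+-identityʳ _) ⟩
    deg G (base p) + deg G (base p)       ≡⟨ cong₂ _+_ (deg-tabulate G (base p)) (deg-tabulate G (base p)) ⟩
    sum (tabulate neighbour) + sum (tabulate neighbour)
      ≤⟨ +-mono-≤ (sum-tabulate-mono n (in-copy left base-left)) (sum-tabulate-mono n (in-copy right base-right)) ⟩
    sum (tabulate (λ u → present (col H p (left u)))) + sum (tabulate (λ u → present (col H p (right u))))
      ≡⟨ sym (sum-tabulate-+ n n (λ q → present (col H p q))) ⟩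
    sum (tabulate (λ q → present (col H p q))) ≡⟨ sym (deg-tabulate H p) ⟩
    deg H p ∎
    where
    open ≤-Reasoning
    neighbour : Fin n → ℕ
    neighbour u = present (col G (base p) u)
    in-copy : (copy : Fin n → Fin (n + n)) → (∀ u → base (copy u) ≡ u) →
      ∀ u → neighbour u ≤ present (col H p (copy u))
    in-copy copy base-copy u = present-mono _ _ λ {k} e →
      blowup p (copy u) (k , trans (cong (col G (base p)) (base-copy u)) e)

Conn-sym : ∀ {n} (G : ColouredGraph n) k {a b} → Conn G k a b → Conn G k b a
Conn-sym G k = symmetric (Edge G k) (λ {u} {v} e → trans (ColouredGraph.sym G v u) e)

Conn-target : ∀ {n} (G : ColouredGraph n) k {a b} → Conn G k a b → Conn G k b b
Conn-target G k c = Conn-sym G k c ⁺++ c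

module Construction {n} (G : ColouredGraph n) (x y : Fin n) (x≢y : x ≢ y) where
  open TwoCopies n public

  NewEdge : Fin (n + n) → Fin (n + n) → Set
  NewEdge p q = (p ≡ left x × q ≡ left y) ⊎ (p ≡ left y × q ≡ left x)

  newEdge? : ∀ p q → Dec (NewEdge p q)
  newEdge? p q = ((p ≟ᶠ left x) ×-dec (q ≟ᶠ left y)) ⊎-dec ((p ≟ᶠ left y) ×-dec (q ≟ᶠ left x))

  NewEdge-sym : ∀ {p q} → NewEdge p q → NewEdge q p
  NewEdge-sym (inj₁ (p≡ , q≡)) = inj₂ (q≡ , p≡)
  NewEdge-sym (inj₂ (p≡ , q≡)) = inj₁ (q≡ , p≡)

  left-x≢left-y : left x ≢ left y
  left-x≢left-y e = x≢y (trans (sym (base-left x)) (trans (cong base e) (base-left y)))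

  ¬NewEdge-right : ∀ u q → ¬ NewEdge (right u) q
  ¬NewEdge-right u q (inj₁ (e , _)) = left≢right x u (sym e)
  ¬NewEdge-right u q (inj₂ (e , _)) = left≢right y u (sym e)

  colour : Fin (n + n) → Fin (n + n) → Maybe Colour
  colour p q with newEdge? p q
  ... | yes _ = just red
  ... | no  _ = col G (base p) (base q)

  colour-new : ∀ {p q} → NewEdge p q → colour p q ≡ just red
  colour-new {p} {q} new with newEdge? p q
  ... | yes _ = refl
  ... | no ¬new = ⊥-elim (¬new new)

  colour-old : ∀ {p q} → ¬ NewEdge p q → colour p q ≡ col G (base p) (base q)
  colour-old {p} {q} ¬new with newEdge? p q
  ... | yes new = ⊥-elim (¬new new)
  ... | no _ = refl

  colour-sym : ∀ p q → colour p q ≡ colour q p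
  colour-sym p q with newEdge? p q | newEdge? q p
  ... | yes _   | yes _    = refl
  ... | yes new | no ¬new  = ⊥-elim (¬new (NewEdge-sym new))
  ... | no ¬new | yes new  = ⊥-elim (¬new (NewEdge-sym new))
  ... | no _    | no _     = ColouredGraph.sym G (base p) (base q)

  colour-irrefl : ∀ p → colour p p ≡ nothing
  colour-irrefl p with newEdge? p p
  ... | yes (inj₁ (p≡x , p≡y)) = ⊥-elim (left-x≢left-y (trans (sym p≡x) p≡y))
  ... | yes (inj₂ (p≡y , p≡x)) = ⊥-elim (left-x≢left-y (trans (sym p≡x) p≡y))
  ... | no _ = ColouredGraph.irrefl G (base p)

  G′ : ColouredGraph (n + n)
  G′ = record { col = colour ; sym = colour-sym ; irrefl = colour-irrefl }

  -- G′ contains the blow-up of G: only the colour of the new edge changed.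
  blowup : ∀ p q → Adjacent G (base p) (base q) → Adjacent G′ p q
  blowup p q adj with newEdge? p q
  ... | yes _ = red , refl
  ... | no  _ = adj

  old-edge : ∀ {k p q} → ¬ NewEdge p q → Edge G k (base p) (base q) → Edge G′ k p q
  old-edge ¬new e = trans (colour-old ¬new) e

  -- An edge x y of G of colour k, possibly overwritten by the new edge,
  -- survives as the walk left x – right y – right x – left y.
  detour : ∀ {k} → Edge G k x y → Conn G′ k (left x) (left y)
  detour {k} e =
    old-edge (¬NewEdge-right y (left x) ∘ NewEdge-sym) (along (base-left x) (base-right y) e) ∷
    old-edge (¬NewEdge-right y (right x)) (along (base-right y) (base-right x) (trans (ColouredGraph.sym G y x) e)) ∷
    [ old-edge (¬NewEdge-right x (left y)) (along (base-right x) (base-left y) e) ]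
    where
    along : ∀ {a b a′ b′} → a′ ≡ a → b′ ≡ b → Edge G k a b → Edge G k a′ b′
    along refl refl e = e

  lift-edge : ∀ {k a b} → Edge G k a b → ∀ p q → base p ≡ a → base q ≡ b → Conn G′ k p q
  lift-edge {k} e p q refl refl with newEdge? p q
  ... | no ¬new = [ old-edge ¬new e ]
  ... | yes (inj₁ (refl , refl)) = detour (subst₂ (Edge G k) (base-left x) (base-left y) e)
  ... | yes (inj₂ (refl , refl)) =
    Conn-sym G′ k (detour (subst₂ (Edge G k) (base-left x) (base-left y) (trans (ColouredGraph.sym G _ _) e)))

  lift : ∀ {k a b} → Conn G k a b → ∀ p q → base p ≡ a → base q ≡ b → Conn G′ k p q
  lift [ e ] p q pa qb = lift-edge e p q pa qb
  lift (_∷_ {y = c} e walk) p q pa qb = lift-edge e p (left c) pa (base-left c) ⁺++ lift walk (left c) q (base-left c) qb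

  module Walks (cx : Conn G red x x) (cy : Conn G red y y) where

    Touches : Fin n → Set
    Touches a = Conn G red x a ⊎ Conn G red y a

    Touches-step : ∀ {a b} → Touches a → Conn G red a b → Touches b
    Touches-step (inj₁ xa) ab = inj₁ (xa ⁺++ ab)
    Touches-step (inj₂ ya) ab = inj₂ (ya ⁺++ ab)

    Touches-back : ∀ {a b} → Touches b → Conn G red a b → Touches a
    Touches-back tb ab = Touches-step tb (Conn-sym G red ab)

    Merged : Colour → Fin n → Fin n → Set
    Merged k a b = Conn G k a b ⊎ (k ≡ red × Touches a × Touches b)

    Merged-trans : ∀ {k a b c} → Merged k a b → Merged k b c → Merged k a c
    Merged-trans (inj₁ ab) (inj₁ bc) = inj₁ (ab ⁺++ bc)
    Merged-trans (inj₁ ab) (inj₂ (refl , tb , tc)) = inj₂ (refl , Touches-back tb ab , tc)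
    Merged-trans (inj₂ (refl , ta , tb)) (inj₁ bc) = inj₂ (refl , ta , Touches-step tb bc)
    Merged-trans (inj₂ (refl , ta , _)) (inj₂ (_ , _ , tc)) = inj₂ (refl , ta , tc)

    Merged-target : ∀ {k a b} → Merged k a b → Conn G k b b
    Merged-target {k} (inj₁ ab) = Conn-target G k ab
    Merged-target (inj₂ (refl , _ , inj₁ xb)) = Conn-target G red xb
    Merged-target (inj₂ (refl , _ , inj₂ yb)) = Conn-target G red yb

    Touches-left-x : Touches (base (left x))
    Touches-left-x = subst Touches (sym (base-left x)) (inj₁ cx)

    Touches-left-y : Touches (base (left y))
    Touches-left-y = subst Touches (sym (base-left y)) (inj₂ cy)

    project-edge : ∀ {k p q} → Edge G′ k p q → Merged k (base p) (base q)
    project-edge {k} {p} {q} e with newEdge? p q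
    ... | no _ = inj₁ [ e ]
    ... | yes (inj₁ (refl , refl)) = inj₂ (just-injective (sym e) , Touches-left-x , Touches-left-y)
    ... | yes (inj₂ (refl , refl)) = inj₂ (just-injective (sym e) , Touches-left-y , Touches-left-x)

    project : ∀ {k p q} → Conn G′ k p q → Merged k (base p) (base q)
    project [ e ] = project-edge e
    project (e ∷ walk) = Merged-trans (project-edge e) (project walk)

    to-left-x : ∀ {a} → Touches a → ∀ p → base p ≡ a → Conn G′ red p (left x)
    to-left-x (inj₁ xa) p pa = lift (Conn-sym G red xa) p (left x) pa (base-left x)
    to-left-x (inj₂ ya) p pa = lift (Conn-sym G red ya) p (left y) pa (base-left y) ⁺++ [ colour-new (inj₂ (refl , refl)) ]

    lift-Merged : ∀ {k a b} → Merged k a b → ∀ p q → base p ≡ a → base q ≡ b → Conn G′ k p q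
    lift-Merged (inj₁ ab) p q pa qb = lift ab p q pa qb
    lift-Merged (inj₂ (refl , ta , tb)) p q pa qb = to-left-x ta p pa ⁺++ Conn-sym G′ red (to-left-x tb q qb)

    Conn⇔Merged : ∀ k p q → Conn G′ k p q ⇔ Merged k (base p) (base q)
    Conn⇔Merged k p q = mk⇔ project (λ m → lift-Merged m p q refl refl)

    components : ∀ k {c} {E : KVertex G k → KVertex G k → Set} →
      (∀ u v → Merged k (proj₁ u) (proj₁ v) ⇔ E u v) → Labelling (KVertex G k) E c → NumComponents G′ k c
    components k {E = E} Merged⇔E = labelling-pullback original Conn⇔E meets
      where
      original : KVertex G′ k → KVertex G k
      original (p , cp) = base p , Merged-target (project cp)
      Conn⇔E : ∀ P Q → Conn G′ k (proj₁ P) (proj₁ Q) ⇔ E (original P) (original Q)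
      Conn⇔E (p , _) (q , _) = mk⇔
        (to (Merged⇔E _ _) ∘ project)
        (λ e → lift-Merged (from (Merged⇔E _ _) e) p q refl refl)
      meets : ∀ v → ∃ λ w → E (original w) v
      meets (a , ca) =
        (left a , lift ca (left a) (left a) (base-left a) (base-left a)) ,
        to (Merged⇔E _ _) (inj₁ (subst (λ b → Conn G k b a) (sym (base-left a)) ca))

    components-other : ∀ k → k ≢ red → ∀ {c} → NumComponents G k c → NumComponents G′ k c
    components-other k k≢red = components k λ _ _ →
      mk⇔ [ id , (λ (k≡red , _) → ⊥-elim (k≢red k≡red)) ]′ inj₁

    components-red : ∀ {r} → ¬ Conn G red x y → NumComponents G red (suc r) → NumComponents G′ red r
    components-red ¬xy count = components red
      (λ _ _ → mk⇔ [ inj₁ , (λ (_ , tu , tv) → inj₂ (tu , tv)) ]′ [ inj₁ , (λ (tu , tv) → inj₂ (refl , tu , tv)) ]′)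
      (labelling-merge (x , cx) (y , cy) ¬xy count)

    shadow : ∀ {k p m} → ComponentOrder G′ k p m →
      Σ (List (Fin n)) λ us → Unique us × (∀ u → u ∈ us ⇔ Merged k (base p) u) × m ≤ length us + length us
    shadow {k} {p} (_ , ps , unique , members , refl) =
      us , DecUnique.deduplicate-! _≟ᶠ_ (map base ps) , members′ ,
      copies-length unique (∈-deduplicate⁺ _≟ᶠ_ ∘ ∈-map⁺ base)
      where
      us : List (Fin n)
      us = deduplicate _≟ᶠ_ (map base ps)
      members′ : ∀ u → u ∈ us ⇔ Merged k (base p) u
      members′ u = mk⇔ below above
        where
        below : u ∈ us → Merged k (base p) u
        below u∈us with ∈-map⁻ base (∈-deduplicate⁻ _≟ᶠ_ (map base ps) u∈us)
        ... | q , q∈ps , refl = project (to (members q) q∈ps)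
        above : Merged k (base p) u → u ∈ us
        above pu = ∈-deduplicate⁺ _≟ᶠ_ (subst (_∈ map base ps) (base-left u)
          (∈-map⁺ base (from (members (left u)) (lift-Merged pu p (left u) refl (base-left u)))))

    Merged-plain : ∀ {k a u} → ¬ (k ≡ red × Touches a) → Merged k a u → Conn G k a u
    Merged-plain _ (inj₁ au) = au
    Merged-plain plain (inj₂ (k≡red , ta , _)) = ⊥-elim (plain (k≡red , ta))

    Merged-touched : ∀ {k a u} → k ≡ red × Touches a → Merged k a u → Touches u
    Merged-touched (refl , ta) (inj₁ au) = Touches-step ta au
    Merged-touched _ (inj₂ (_ , _ , tu)) = tu

    Merged-touched-back : ∀ {a u} → Touches u → Merged red a u → Touches a
    Merged-touched-back tu (inj₁ au) = Touches-back tu au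
    Merged-touched-back _ (inj₂ (_ , ta , _)) = ta

    -- For an enumerated class, which case applies is decidable: check whether
    -- x or y is listed.
    classify : ∀ k {a us} → (∀ u → u ∈ us ⇔ Merged k a u) → Dec (k ≡ red × Touches a)
    classify blue  _ = no λ ()
    classify green _ = no λ ()
    classify red {a} {us} members =
      map′ ((refl ,_) ∘ [ Merged-touched-back (inj₁ cx) ∘ to (members x) , Merged-touched-back (inj₂ cy) ∘ to (members y) ]′)
           (listed ∘ proj₂)
           (any? (x ≟ᶠ_) us ⊎-dec any? (y ≟ᶠ_) us)
      where
      listed : Touches a → x ∈ us ⊎ y ∈ us
      listed (inj₁ xa) = inj₁ (from (members x) (inj₁ (Conn-sym G red xa)))
      listed (inj₂ ya) = inj₂ (from (members y) (inj₁ (Conn-sym G red ya)))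

    class-small : NoLargeMonoComponent G → ∀ {m₁ m₂} →
      ComponentOrder G red x m₁ → ComponentOrder G red y m₂ → 2 * (m₁ + m₂) < n →
      ∀ k {a us} → Merged k a a → Unique us → (∀ u → u ∈ us ⇔ Merged k a u) → 2 * length us < n
    class-small noLarge (_ , xs₁ , _ , members₁ , refl) (_ , xs₂ , _ , members₂ , refl) small k {a} {us} aa unique members
      with classify k members
    ... | no plain =
      noLarge k a (length us)
        (Merged-plain plain aa , us , unique , (λ u → mk⇔ (Merged-plain plain ∘ to (members u)) (from (members u) ∘ inj₁)) , refl)
    ... | yes touched = ≤-<-trans (*-monoʳ-≤ 2 us≤R₁∪R₂) small
      where
      us⊆R₁∪R₂ : us ⊆ xs₁ ++ xs₂
      us⊆R₁∪R₂ {u} u∈us = [ ∈-++⁺ˡ ∘ from (members₁ u) , ∈-++⁺ʳ xs₁ ∘ from (members₂ u) ]′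
        (Merged-touched touched (to (members u) u∈us))
      us≤R₁∪R₂ : length us ≤ length xs₁ + length xs₂
      us≤R₁∪R₂ = subst (length us ≤_) (length-++ xs₁) (unique⊆⇒length≤ unique us⊆R₁∪R₂)

    no-large-component : NoLargeMonoComponent G → ∀ {m₁ m₂} →
      ComponentOrder G red x m₁ → ComponentOrder G red y m₂ → 2 * (m₁ + m₂) < n →
      NoLargeMonoComponent G′
    no-large-component noLarge R₁ R₂ small k p m order with shadow order
    ... | us , unique , members , m≤2us =
      double-< {u = length us} m≤2us (class-small noLarge R₁ R₂ small k (project (proj₁ order)) unique members)

lemma3p4 : (n : ℕ) (G : ColouredGraph n) (r b g : ℕ) →
    NoLargeMonoComponent G →
    NumComponents G red r → NumComponents G blue b → NumComponents G green g →
    (v₁ v₂ : Fin n) (m₁ m₂ : ℕ) →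
    ComponentOrder G red v₁ m₁ → ComponentOrder G red v₂ m₂ →
    ¬ Conn G red v₁ v₂ →
    2 * (m₁ + m₂) < n →
    Σ ℕ λ n′ → Σ (ColouredGraph n′) λ G′ →
      NumComponents G′ red (r ∸ 1) × NumComponents G′ blue b ×
      NumComponents G′ green g ×
      minDeg G * n′ ≤ minDeg G′ * n ×
      NoLargeMonoComponent G′
-- There are no vertices v₁ in an empty graph, and no red vertex without a red label.
lemma3p4 zero G r b g _ _ _ _ () _ _ _ _ _ _ _
lemma3p4 (suc n) G zero b g _ (label , _) _ _ v₁ _ _ _ R₁ _ _ _ with label (v₁ , proj₁ R₁)
... | ()
lemma3p4 (suc n) G (suc r) b g noLarge reds blues greens v₁ v₂ m₁ m₂ R₁ R₂ ¬v₁v₂ small =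
  suc n + suc n , G′ ,
  components-red ¬v₁v₂ reds ,
  components-other blue (λ ()) blues ,
  components-other green (λ ()) greens ,
  scale-by-order {minDeg G} (suc n) (minDeg-scale 2 G G′ base (deg-blowup G G′ blowup)) ,
  no-large-component noLarge R₁ R₂ small
  where
  open Construction G v₁ v₂ (λ v₁≡v₂ → ¬v₁v₂ (subst (Conn G red v₁) v₁≡v₂ (proj₁ R₁)))
  open Walks (proj₁ R₁) (proj₁ R₂)
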